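{- Work in Bishop-style constructive mathematics (BISH) augmented by the principle BD-$\mathbf{N}$. Then every permutably convergent series $\sum_{n=1}^{\infty} a_n$ of real numbers is absolutely convergent, i.e. $\sum_{n=1}^\infty |a_n|$ converges.
   Context: BISH is Bishop-style constructive mathematics: mathematics with intuitionistic logic (together with dependent choice). $\mathbf{N}^+$ denotes the set of positive integers. A series $\sum a_n$ of real numbers is permutably convergent if for every permutation $\sigma$ of $\mathbf{N}^+$ the series $\sum a_{\sigma(n)}$ converges in $\mathbf{R}$. A subset $S$ of $\mathbf{N}^+$ is pseudobounded if for every sequence $(s_n)_{n\geq 1}$ in $S$ there exists $N$ such that $s_n/n<1$ for all $n\geq N$ (equivalently $s_n/n\to 0$). BD-$\mathbf{N}$ is the principle: every inhabited, countable, pseudobounded subset of $\mathbf{N}^+$ is bounded. -}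

module Defs where

open import Level using (0ℓ)
open import Data.Nat as ℕ using (ℕ; zero; suc; _<_)
import Data.Nat.Properties as ℕP
open import Data.Nat.Tactic.RingSolver using (solve-∀)
open import Data.Integer as ℤ using (ℤ; +_)
open import Data.Rational.Unnormalised
  using (ℚᵘ; mkℚᵘ; 0ℚᵘ; _+_; -_; _-_; ∣_∣; _≤_; _≃_; *≤*; *≡*)
open import Data.Rational.Unnormalised.Properties
  using (≤-trans; ≤-reflexive; ≤-refl; +-mono-≤; ∣-∣-cong; ∣p+q∣≤∣p∣+∣q∣;
         ∣p∣≡p∨∣p∣≡-p; ∣-p∣≃∣p∣; ≃-refl; ≃-sym; ≃-trans; ≃-reflexive; 0≤∣p∣)
open import Data.Rational.Unnormalised.Solver
open import Data.Product using (Σ; ∃; _×_; _,_)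
open import Data.Sum using (inj₁; inj₂)
open import Relation.Binary.PropositionalEquality using (_≡_; refl; cong; subst)
open import Relation.Unary using (Pred)
open import Function.Bundles using (_↔_; Inverse)

-- Conventions.  A positive integer n ∈ ℕ⁺ is represented by the
-- natural number k = n - 1; so a sequence (x_n)_{n ≥ 1} is a function
-- ℕ → _ whose value at k is x_{k+1}.

inv : ℕ → ℚᵘ
inv k = mkℚᵘ (+ 1) k

0≤inv : ∀ k → 0ℚᵘ ≤ inv k
0≤inv k = *≤* (ℤ.+≤+ ℕ.z≤n)

0≤inv+inv : ∀ m n → 0ℚᵘ ≤ inv m + inv n
0≤inv+inv m n = ≤-trans (≤-reflexive (*≡* refl)) (+-mono-≤ (0≤inv m) (0≤inv n))

half-lemma : ∀ k → inv (suc (2 ℕ.* k)) + inv (suc (2 ℕ.* k)) ≤ inv k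
half-lemma k = ≤-reflexive (*≡* (cong +_ (helper k)))
  where
  helper : ∀ k → (1 ℕ.* suc (suc (2 ℕ.* k)) ℕ.+ 1 ℕ.* suc (suc (2 ℕ.* k))) ℕ.* suc k
               ≡ 1 ℕ.* (suc (suc (2 ℕ.* k)) ℕ.* suc (suc (2 ℕ.* k)))
  helper = solve-∀

open +-*-Solver

∣∣≤ : ∀ {t c} → t ≤ c → - t ≤ c → ∣ t ∣ ≤ c
∣∣≤ {t} t≤c -t≤c with ∣p∣≡p∨∣p∣≡-p t
... | inj₁ eq = subst (_≤ _) (Relation.Binary.PropositionalEquality.sym eq) t≤c
... | inj₂ eq = subst (_≤ _) (Relation.Binary.PropositionalEquality.sym eq) -t≤c

add-lemma : ∀ a b c d → ∣ (a + b) - (c + d) ∣ ≤ ∣ a - c ∣ + ∣ b - d ∣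
add-lemma a b c d =
  ≤-trans (≤-reflexive (∣-∣-cong eq)) (∣p+q∣≤∣p∣+∣q∣ (a - c) (b - d))
  where
  eq : (a + b) - (c + d) ≃ (a - c) + (b - d)
  eq = solve 4 (λ a b c d → (a :+ b) :- (c :+ d) := (a :- c) :+ (b :- d)) ≃-refl a b c d

neg-lemma : ∀ a b → ∣ (- a) - (- b) ∣ ≃ ∣ a - b ∣
neg-lemma a b = ≃-trans (∣-∣-cong eq) (∣-p∣≃∣p∣ (a - b))
  where
  eq : (- a) - (- b) ≃ - (a - b)
  eq = solve 2 (λ a b → (:- a) :- (:- b) := :- (a :- b)) ≃-refl a b

sub-le : ∀ {a b c} → a ≤ c + b → a - b ≤ c
sub-le {a} {b} {c} p =
  ≤-trans (+-mono-≤ p (≤-refl { - b}))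
          (≤-reflexive (solve 2 (λ c b → (c :+ b) :- b := c) ≃-refl c b))

abs-lemma : ∀ a b → ∣ ∣ a ∣ - ∣ b ∣ ∣ ≤ ∣ a - b ∣
abs-lemma a b = ∣∣≤ (part a b) (≤-trans (≤-reflexive eq1)
                                  (≤-trans (part b a) (≤-reflexive eq2)))
  where
  part : ∀ a b → ∣ a ∣ - ∣ b ∣ ≤ ∣ a - b ∣
  part a b = sub-le (≤-trans (≤-reflexive (∣-∣-cong e)) (∣p+q∣≤∣p∣+∣q∣ (a - b) b))
    where e : a ≃ (a - b) + b
          e = solve 2 (λ a b → a := (a :- b) :+ b) ≃-refl a b
  eq1 : - (∣ a ∣ - ∣ b ∣) ≃ ∣ b ∣ - ∣ a ∣
  eq1 = solve 2 (λ x y → :- (x :- y) := y :- x) ≃-refl ∣ a ∣ ∣ b ∣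
  eq2 : ∣ b - a ∣ ≃ ∣ a - b ∣
  eq2 = ≃-trans (∣-∣-cong (solve 2 (λ a b → b :- a := :- (a :- b)) ≃-refl a b))
                (∣-p∣≃∣p∣ (a - b))

record ℝ : Set where
  constructor mkℝ
  field
    seq : ℕ → ℚᵘ
    reg : ∀ m n → ∣ seq m - seq n ∣ ≤ inv m + inv n
open ℝ public

_* : ℚᵘ → ℝ
q * = mkℝ (λ _ → q) (λ m n →
  ≤-trans (≤-reflexive (∣-∣-cong (solve 1 (λ q → q :- q := con 0ℚᵘ) ≃-refl q)))
          (≤-trans (≤-reflexive (*≡* refl)) (0≤inv+inv m n)))

0ᵣ : ℝ
0ᵣ = 0ℚᵘ *

-- Bishop's sum:  (x + y)_n = x_{2n} + y_{2n}
-- (in our indexing, positive integer 2(k+1) is index 2k+1)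
_+ᵣ_ : ℝ → ℝ → ℝ
x +ᵣ y = mkℝ (λ k → seq x (suc (2 ℕ.* k)) + seq y (suc (2 ℕ.* k))) r
  where
  r : ∀ m n → ∣ (seq x (suc (2 ℕ.* m)) + seq y (suc (2 ℕ.* m))) - (seq x (suc (2 ℕ.* n)) + seq y (suc (2 ℕ.* n))) ∣ ≤ inv m + inv n
  r m n = ≤-trans (add-lemma (seq x m') (seq y m') (seq x n') (seq y n'))
    (≤-trans (+-mono-≤ (reg x m' n') (reg y m' n'))
    (≤-trans (≤-reflexive
       (solve 2 (λ i j → (i :+ j) :+ (i :+ j) := (i :+ i) :+ (j :+ j)) ≃-refl (inv m') (inv n')))
       (+-mono-≤ (half-lemma m) (half-lemma n))))
    where m' = suc (2 ℕ.* m)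
          n' = suc (2 ℕ.* n)

-ᵣ_ : ℝ → ℝ
-ᵣ x = mkℝ (λ k → - seq x k) (λ m n → ≤-trans (≤-reflexive (neg-lemma (seq x m) (seq x n))) (reg x m n))

_-ᵣ_ : ℝ → ℝ → ℝ
x -ᵣ y = x +ᵣ (-ᵣ y)

∣_∣ᵣ : ℝ → ℝ
∣ x ∣ᵣ = mkℝ (λ k → ∣ seq x k ∣) (λ m n → ≤-trans (abs-lemma (seq x m) (seq x n)) (reg x m n))

NonNegᵣ : ℝ → Set
NonNegᵣ x = ∀ n → - inv n ≤ seq x n

_≤ᵣ_ : ℝ → ℝ → Set
x ≤ᵣ y = NonNegᵣ (y -ᵣ x)

_ConvergesTo_ : (ℕ → ℝ) → ℝ → Set
x ConvergesTo s = ∀ k → ∃ λ N → ∀ n → N ℕ.≤ n → ∣ x n -ᵣ s ∣ᵣ ≤ᵣ (inv k *)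

Convergent : (ℕ → ℝ) → Set
Convergent x = ∃ λ s → x ConvergesTo s

partialSum : (ℕ → ℝ) → ℕ → ℝ
partialSum a zero    = 0ᵣ
partialSum a (suc n) = partialSum a n +ᵣ a n

SeriesConverges : (ℕ → ℝ) → Set
SeriesConverges a = Convergent (partialSum a)

PermutablyConvergent : (ℕ → ℝ) → Set
PermutablyConvergent a = (σ : ℕ ↔ ℕ) → SeriesConverges (λ n → a (Inverse.to σ n))

AbsolutelyConvergent : (ℕ → ℝ) → Set
AbsolutelyConvergent a = SeriesConverges (λ n → ∣ a n ∣ᵣ)

-- BD-ℕ.  Here subsets of ℕ⁺ are literally predicates on ℕ whose
-- elements are all positive, and sequences (s_n)_{n≥1} are functions
-- ℕ → ℕ with s k = s_{k+1}.

SubsetOfℕ⁺ : Pred ℕ 0ℓ → Set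
SubsetOfℕ⁺ S = ∀ m → S m → 0 < m

Inhabited : Pred ℕ 0ℓ → Set
Inhabited S = ∃ λ m → S m

Countable : Pred ℕ 0ℓ → Set
Countable S = ∃ λ (f : ℕ → ℕ) → (∀ k → S (f k)) × (∀ m → S m → ∃ λ k → f k ≡ m)

-- pseudobounded: for every sequence (s_n) in S there is N with
-- s_n / n < 1 (i.e. s_n < n) for all n ≥ N
Pseudobounded : Pred ℕ 0ℓ → Set
Pseudobounded S = ∀ (s : ℕ → ℕ) → (∀ k → S (s k)) →
  ∃ λ N → ∀ k → N ℕ.≤ k → s k < suc k

Bounded : Pred ℕ 0ℓ → Set
Bounded S = ∃ λ B → ∀ m → S m → m ℕ.≤ B

BD-ℕ : Set₁
BD-ℕ = ∀ (S : Pred ℕ 0ℓ) → SubsetOfℕ⁺ S → Inhabited S → Countable S →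
  Pseudobounded S → Bounded S

module Submission where

-- Fix a tolerance ε = 1/(E+1).  Let S ⊆ ℕ⁺ consist of 1 together with every
-- x > 0 for which some t > x makes the block sum  Σ_{x ≤ i < t} |a_i|
-- (evaluated with rational approximations of a precision depending on t)
-- exceed ε.  S is decidable in (x, t), hence countable, and inhabited.
-- S is pseudobounded: given a sequence (s_k) in S, greedily select pairwise
-- disjoint big blocks [s_k, t) with s_k > k and reorder each selected block
-- so that its nonnegative terms come before its negative ones.  This is a
-- permutation σ, so Σ a_σ(n) converges and its far-out blocks are small; a
-- selected block is then the difference of two small blocks, so it is not
-- big — hence only finitely many blocks are selected and s_k ≤ k eventually.
-- BD-ℕ bounds S, so all blocks beyond the bound have absolute sum ≤ ε.
-- Finally, a series whose tails of |a_n| are uniformly small converges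
-- absolutely: the limit is built directly as a regular sequence of rationals.

open import Defs
open import Data.Empty using (⊥; ⊥-elim)
open import Data.Product using (∃; _×_; _,_; proj₁; proj₂)
open import Data.Sum using (_⊎_; inj₁; inj₂)
open import Data.Maybe using (Maybe; just; nothing; _<∣>_)
open import Function.Bundles using (_↔_; mk↔ₛ′)
open import Relation.Nullary using (¬_; Dec; yes; no; ¬?; _×-dec_)
open import Relation.Unary using (Decidable)
open import Relation.Binary.Definitions using (tri<; tri≈; tri>)
open import Relation.Binary.PropositionalEquality
  using (_≡_; refl; sym; trans; cong; cong₂; subst; subst₂)

open import Data.Nat using (ℕ)
open import Data.Nat as N using (zero; suc)
import Data.Nat.Properties as NP
open import Data.Nat.Tactic.RingSolver using (solve-∀)
import Data.Integer as Z
import Data.Integer.Properties as ZP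
import Data.Integer.Solver as ZS
open import Data.Rational.Unnormalised
  using (ℚᵘ; mkℚᵘ; 0ℚᵘ; _+_; -_; _-_; ∣_∣; _≤_; _<_; _≃_; *≤*; *≡*; *<*)
import Data.Rational.Unnormalised.Properties as QP
open import Data.Rational.Unnormalised.Solver

open import Data.List using (List; []; _∷_; _++_; map; length; filter)
import Data.List.Properties as LP
open import Data.List.Membership.Propositional using (_∈_)
open import Data.List.Membership.Propositional.Properties
  using (∈-++⁺ˡ; ∈-++⁺ʳ; ∈-++⁻; ∈-filter⁺; ∈-filter⁻)
open import Data.List.Relation.Unary.Any using (here; there)
import Data.List.Relation.Unary.All as All
open import Data.List.Relation.Unary.AllPairs using ([]; _∷_)
open import Data.List.Relation.Unary.Unique.Propositional using (Unique)
import Data.List.Relation.Unary.Unique.Propositional.Properties as Unique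

open QP using (≤-trans; ≤-refl; ≤-reflexive; ≃-refl; ≃-sym; ≃-trans; +-mono-≤; ∣p+q∣≤∣p∣+∣q∣; 0≤∣p∣)
open QP.≤-Reasoning

frac : ℕ → ℕ → ℚᵘ
frac n d = mkℚᵘ (Z.+ n) d

frac-≤ : ∀ {n d n' d'} → n N.* suc d' N.≤ n' N.* suc d → frac n d ≤ frac n' d'
frac-≤ {n} {d} {n'} {d'} h =
  *≤* (subst₂ Z._≤_ (ZP.pos-* n (suc d')) (ZP.pos-* n' (suc d)) (Z.+≤+ h))

frac-+ : ∀ a b d → frac a d + frac b d ≃ frac (a N.+ b) d
frac-+ a b d = *≡* (trans (ZS.+-*-Solver.solve 3
    (λ A B D → (A :* D :+ B :* D) :* D := (A :+ B) :* (D :* D)) refl (Z.+ a) (Z.+ b) (Z.+ suc d))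
    (cong (Z._* (Z.+ suc d Z.* Z.+ suc d)) (sym (ZP.pos-+ a b))))
  where open ZS.+-*-Solver

open +-*-Solver

frac-antitone : ∀ n {d d'} → d N.≤ d' → frac n d' ≤ frac n d
frac-antitone n h = frac-≤ (NP.*-monoʳ-≤ n (N.s≤s h))

frac-mono : ∀ {n n'} d → n N.≤ n' → frac n d ≤ frac n' d
frac-mono d h = frac-≤ (NP.*-monoˡ-≤ (suc d) h)

frac-nonneg : ∀ n d → 0ℚᵘ ≤ frac n d
frac-nonneg n d = QP.nonNegative⁻¹ (frac n d)

nonneg-+ : ∀ {p q} → 0ℚᵘ ≤ p → 0ℚᵘ ≤ q → 0ℚᵘ ≤ p + q
nonneg-+ 0≤p 0≤q = ≤-trans (≤-reflexive (≃-sym (QP.+-identityˡ 0ℚᵘ))) (+-mono-≤ 0≤p 0≤q)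

≤-+-nonneg : ∀ {p r} → 0ℚᵘ ≤ r → p ≤ p + r
≤-+-nonneg {p} 0≤r = ≤-trans (≤-reflexive (≃-sym (QP.+-identityʳ p))) (QP.+-monoʳ-≤ p 0≤r)

≤-nonneg-+ : ∀ {p r} → 0ℚᵘ ≤ r → p ≤ r + p
≤-nonneg-+ {p} 0≤r = ≤-trans (≤-reflexive (≃-sym (QP.+-identityˡ p))) (QP.+-monoˡ-≤ p 0≤r)

≤-up-to-slack : ∀ D {y x} → (∀ j → y ≤ x + frac D j) → y ≤ x
≤-up-to-slack D {y} {x} h = QP.0≤q-p⇒p≤q (nonneg (x - y) λ j → begin
  0ℚᵘ              ≤⟨ QP.p≤q⇒0≤q-p (h j) ⟩
  (x + frac D j) - y ≃⟨ solve 3 (λ x f y → (x :+ f) :- y := (x :- y) :+ f) ≃-refl x (frac D j) y ⟩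
  (x - y) + frac D j ∎)
  where
  nonneg : ∀ z → (∀ j → 0ℚᵘ ≤ z + frac D j) → 0ℚᵘ ≤ z
  nonneg (mkℚᵘ (Z.+ n) e) h = QP.nonNegative⁻¹ (mkℚᵘ (Z.+ n) e)
  nonneg z@(mkℚᵘ Z.-[1+ p ] e) h = ⊥-elim (QP.<⇒≱ z+slack<0 (h j))
    where
    j = D N.* suc e
    slack<1/e : frac D j < frac 1 e
    slack<1/e = *<* (subst₂ Z._<_ (ZP.pos-* D (suc e)) (ZP.pos-* 1 (suc j))
                 (Z.+<+ (subst (D N.* suc e N.<_) (sym (NP.*-identityˡ (suc j))) (NP.n<1+n _))))
    1/e≤-z : frac 1 e ≤ - z
    1/e≤-z = frac-mono e (N.s≤s N.z≤n)
    z+slack<0 : z + frac D j < 0ℚᵘ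
    z+slack<0 = begin-strict
      z + frac D j <⟨ QP.+-monoʳ-< z (QP.<-≤-trans slack<1/e 1/e≤-z) ⟩
      z + (- z)    ≃⟨ QP.+-inverseʳ z ⟩
      0ℚᵘ          ∎

p≤∣p∣ : ∀ p → p ≤ ∣ p ∣
p≤∣p∣ p with QP.∣p∣≡p∨∣p∣≡-p p
... | inj₁ eq = ≤-reflexive (QP.≃-reflexive (sym eq))
... | inj₂ eq = ≤-trans (QP.neg-cancel-≤ (≤-trans (0≤∣p∣ p) (≤-reflexive (QP.≃-reflexive eq)))) (0≤∣p∣ p)

dist-triangle : ∀ a b c → ∣ a - c ∣ ≤ ∣ a - b ∣ + ∣ b - c ∣
dist-triangle a b c = ≤-trans (≤-reflexive (QP.∣-∣-cong
  (solve 3 (λ a b c → a :- c := (a :- b) :+ (b :- c)) ≃-refl a b c)))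
  (∣p+q∣≤∣p∣+∣q∣ (a - b) (b - c))

dist-sym : ∀ a b → ∣ a - b ∣ ≃ ∣ b - a ∣
dist-sym a b = ≃-trans (QP.∣-∣-cong (solve 2 (λ a b → a :- b := :- (b :- a)) ≃-refl a b))
                       (QP.∣-p∣≃∣p∣ (b - a))

-- The approximation of  c* -ᵣ ∣ x -ᵣ y ∣ᵣ  at index j samples x and y at
-- index diffIndex j.
diffIndex : ℕ → ℕ
diffIndex j = suc (2 N.* suc (2 N.* j))

≤-diffIndex : ∀ j → j N.≤ diffIndex j
≤-diffIndex j = NP.≤-trans (NP.m≤n*m j 2) (NP.≤-trans (NP.n≤1+n _)
  (NP.≤-trans (NP.m≤n*m (suc (2 N.* j)) 2) (NP.n≤1+n _)))

nonneg-up-to-slack : ∀ (z : ℝ) D → (∀ j → - frac D j ≤ seq z j) → NonNegᵣ z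
nonneg-up-to-slack z D h n = ≤-up-to-slack (suc D) λ j → begin
  - inv n
    ≃⟨ solve 3 (λ f i k → :- k := ((:- f) :- (i :+ k)) :+ (i :+ f)) ≃-refl (frac D j) (inv j) (inv n) ⟩
  ((- frac D j) - (inv j + inv n)) + (inv j + frac D j)
    ≤⟨ QP.+-monoˡ-≤ (inv j + frac D j) (QP.+-monoˡ-≤ (- (inv j + inv n)) (h j)) ⟩
  (seq z j - (inv j + inv n)) + (inv j + frac D j)
    ≤⟨ QP.+-monoˡ-≤ (inv j + frac D j) (sub-≤ {seq z j} {seq z n} (≤-trans (p≤∣p∣ (seq z j - seq z n)) (reg z j n))) ⟩
  seq z n + (inv j + frac D j)
    ≃⟨ QP.+-congʳ (seq z n) (frac-+ 1 D j) ⟩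
  seq z n + frac (suc D) j ∎
  where
  sub-≤ : ∀ {x y w} → x - y ≤ w → x - w ≤ y
  sub-≤ {x} {y} {w} h = begin
    x - w             ≃⟨ solve 3 (λ x y w → x :- w := ((x :- y) :- w) :+ y) ≃-refl x y w ⟩
    ((x - y) - w) + y ≤⟨ QP.+-monoˡ-≤ y (QP.+-monoˡ-≤ (- w) h) ⟩
    (w - w) + y       ≃⟨ solve 2 (λ w y → (w :- w) :+ y := y) ≃-refl w y ⟩
    y                 ∎

dist-≤ᵣ : ∀ x y c C → (∀ m → ∣ seq x m - seq y m ∣ ≤ c + frac C m) → ∣ x -ᵣ y ∣ᵣ ≤ᵣ (c *)
dist-≤ᵣ x y c C h = nonneg-up-to-slack ((c *) -ᵣ ∣ x -ᵣ y ∣ᵣ) C λ j →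
  let m = diffIndex j in begin
  - frac C j         ≃⟨ solve 2 (λ c f → :- f := c :- (c :+ f)) ≃-refl c (frac C j) ⟩
  c - (c + frac C j) ≤⟨ QP.+-monoʳ-≤ c (QP.neg-mono-≤ (≤-trans (h m)
                          (QP.+-monoʳ-≤ c (frac-antitone C (≤-diffIndex j))))) ⟩
  c - ∣ seq x m - seq y m ∣ ∎

dist-≤ℚ : ∀ x y c → ∣ x -ᵣ y ∣ᵣ ≤ᵣ (c *) → ∀ m → ∣ seq x m - seq y m ∣ ≤ c + frac 5 m
dist-≤ℚ x y c h m = begin
  ∣ seq x m - seq y m ∣
    ≤⟨ ≤-trans (dist-triangle (seq x m) (seq x m') (seq y m))
               (QP.+-monoʳ-≤ ∣ seq x m - seq x m' ∣ (dist-triangle (seq x m') (seq y m') (seq y m))) ⟩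
  ∣ seq x m - seq x m' ∣ + (∣ seq x m' - seq y m' ∣ + ∣ seq y m' - seq y m ∣)
    ≤⟨ +-mono-≤ (reg x m m') (+-mono-≤ at-m' (reg y m' m)) ⟩
  (inv m + inv m') + ((c + inv m) + (inv m' + inv m))
    ≤⟨ +-mono-≤ (QP.+-monoʳ-≤ (inv m) 1/m'≤1/m) (QP.+-monoʳ-≤ (c + inv m) (QP.+-monoˡ-≤ (inv m) 1/m'≤1/m)) ⟩
  (inv m + inv m) + ((c + inv m) + (inv m + inv m))
    ≃⟨ solve 2 (λ i c → (i :+ i) :+ ((c :+ i) :+ (i :+ i)) := c :+ (((i :+ i) :+ (i :+ i)) :+ i))
             ≃-refl (inv m) c ⟩
  c + (((inv m + inv m) + (inv m + inv m)) + inv m)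
    ≃⟨ QP.+-congʳ c (≃-trans (QP.+-congˡ (inv m) (≃-trans (QP.+-cong (frac-+ 1 1 m) (frac-+ 1 1 m))
                                                           (frac-+ 2 2 m)))
                             (frac-+ 4 1 m)) ⟩
  c + frac 5 m ∎
  where
  m' = diffIndex m
  1/m'≤1/m : inv m' ≤ inv m
  1/m'≤1/m = frac-antitone 1 (≤-diffIndex m)
  at-m' : ∣ seq x m' - seq y m' ∣ ≤ c + inv m
  at-m' = begin
    ∣ seq x m' - seq y m' ∣
      ≃⟨ solve 3 (λ w c i → w := (c :+ i) :- (c :- w :+ i)) ≃-refl _ c (inv m) ⟩
    (c + inv m) - ((c - ∣ seq x m' - seq y m' ∣) + inv m)
      ≤⟨ QP.+-monoʳ-≤ (c + inv m) (QP.neg-mono-≤ (QP.+-monoˡ-≤ (inv m) (h m))) ⟩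
    (c + inv m) - (- inv m + inv m)
      ≃⟨ solve 2 (λ c i → (c :+ i) :- ((:- i) :+ i) := c :+ i) ≃-refl c (inv m) ⟩
    c + inv m ∎

interval : ℕ → ℕ → List ℕ
interval u zero    = []
interval u (suc n) = u ∷ interval (suc u) n

∑ : (ℕ → ℚᵘ) → List ℕ → ℚᵘ
∑ f []       = 0ℚᵘ
∑ f (x ∷ xs) = f x + ∑ f xs

length-interval : ∀ u n → length (interval u n) ≡ n
length-interval u zero    = refl
length-interval u (suc n) = cong suc (length-interval (suc u) n)

interval-++ : ∀ u a b → interval u (a N.+ b) ≡ interval u a ++ interval (u N.+ a) b
interval-++ u zero    b = cong (λ v → interval v b) (sym (NP.+-identityʳ u))
interval-++ u (suc a) b = cong (u ∷_) (trans (interval-++ (suc u) a b)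
  (cong (λ v → interval (suc u) a ++ interval v b) (sym (NP.+-suc u a))))

interval-split : ∀ {u v w} → u N.≤ v → v N.≤ w →
  interval u (w N.∸ u) ≡ interval u (v N.∸ u) ++ interval v (w N.∸ v)
interval-split {u} {v} {w} u≤v v≤w =
  trans (cong (interval u) (sym lengths))
  (trans (interval-++ u (v N.∸ u) (w N.∸ v))
         (cong (λ z → interval u (v N.∸ u) ++ interval z (w N.∸ v)) (NP.m+[n∸m]≡n u≤v)))
  where
  lengths : (v N.∸ u) N.+ (w N.∸ v) ≡ w N.∸ u
  lengths = NP.+-cancelˡ-≡ u _ _ (trans (sym (NP.+-assoc u (v N.∸ u) (w N.∸ v)))
    (trans (cong (N._+ (w N.∸ v)) (NP.m+[n∸m]≡n u≤v))
    (trans (NP.m+[n∸m]≡n v≤w) (sym (NP.m+[n∸m]≡n (NP.≤-trans u≤v v≤w))))))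

∑-++ : ∀ f xs ys → ∑ f (xs ++ ys) ≃ ∑ f xs + ∑ f ys
∑-++ f []       ys = ≃-sym (QP.+-identityˡ (∑ f ys))
∑-++ f (x ∷ xs) ys = ≃-trans (QP.+-congʳ (f x) (∑-++ f xs ys))
  (≃-sym (QP.+-assoc (f x) (∑ f xs) (∑ f ys)))

∑-map : ∀ f g xs → ∑ f (map g xs) ≡ ∑ (λ i → f (g i)) xs
∑-map f g []       = refl
∑-map f g (x ∷ xs) = cong (f (g x) +_) (∑-map f g xs)

∑-nonneg : ∀ f xs → (∀ i → 0ℚᵘ ≤ f i) → 0ℚᵘ ≤ ∑ f xs
∑-nonneg f []       h = ≤-refl
∑-nonneg f (x ∷ xs) h = nonneg-+ (h x) (∑-nonneg f xs h)

∑-split : ∀ f {u v w} → u N.≤ v → v N.≤ w →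
  ∑ f (interval u (w N.∸ u)) ≃ ∑ f (interval u (v N.∸ u)) + ∑ f (interval v (w N.∸ v))
∑-split f {u} {v} {w} u≤v v≤w =
  ≃-trans (QP.≃-reflexive (cong (∑ f) (interval-split u≤v v≤w)))
          (∑-++ f (interval u (v N.∸ u)) (interval v (w N.∸ v)))

∑-suffix-≤ : ∀ f {u v w} → (∀ i → 0ℚᵘ ≤ f i) → u N.≤ v → v N.≤ w →
  ∑ f (interval v (w N.∸ v)) ≤ ∑ f (interval u (w N.∸ u))
∑-suffix-≤ f {u} {v} {w} f≥0 u≤v v≤w = begin
  ∑ f (interval v (w N.∸ v))
    ≃⟨ ≃-sym (QP.+-identityˡ _) ⟩
  0ℚᵘ + ∑ f (interval v (w N.∸ v))
    ≤⟨ QP.+-monoˡ-≤ _ (∑-nonneg f (interval u (v N.∸ u)) f≥0) ⟩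
  ∑ f (interval u (v N.∸ u)) + ∑ f (interval v (w N.∸ v))
    ≃⟨ ≃-sym (∑-split f u≤v v≤w) ⟩
  ∑ f (interval u (w N.∸ u)) ∎

∑-snoc : ∀ f n → ∑ f (interval 0 (suc n)) ≃ ∑ f (interval 0 n) + f n
∑-snoc f n = ≃-trans
  (QP.≃-reflexive (cong (∑ f) (trans (cong (interval 0) (NP.+-comm 1 n)) (interval-++ 0 n 1))))
  (≃-trans (∑-++ f (interval 0 n) (n ∷ [])) (QP.+-congʳ (∑ f (interval 0 n)) (QP.+-identityʳ (f n))))

∑-perturb : ∀ f g m M xs → (∀ i → ∣ f i - g i ∣ ≤ inv m + inv M) →
  ∣ ∑ f xs - ∑ g xs ∣ ≤ frac (length xs) m + frac (length xs) M
∑-perturb f g m M [] h =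
  ≤-trans (≤-reflexive (QP.∣-∣-cong (QP.+-inverseʳ 0ℚᵘ))) (nonneg-+ (frac-nonneg 0 m) (frac-nonneg 0 M))
∑-perturb f g m M (x ∷ xs) h = begin
  ∣ (f x + ∑ f xs) - (g x + ∑ g xs) ∣     ≤⟨ add-lemma (f x) (∑ f xs) (g x) (∑ g xs) ⟩
  ∣ f x - g x ∣ + ∣ ∑ f xs - ∑ g xs ∣     ≤⟨ +-mono-≤ (h x) (∑-perturb f g m M xs h) ⟩
  (inv m + inv M) + (frac n m + frac n M)
    ≃⟨ solve 4 (λ a b c d → (a :+ b) :+ (c :+ d) := (a :+ c) :+ (b :+ d)) ≃-refl
             (inv m) (inv M) (frac n m) (frac n M) ⟩
  (inv m + frac n m) + (inv M + frac n M) ≃⟨ QP.+-cong (frac-+ 1 n m) (frac-+ 1 n M) ⟩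
  frac (suc n) m + frac (suc n) M         ∎
  where n = length xs

partialSum-approx : ∀ (b : ℕ → ℝ) n m M →
  ∣ seq (partialSum b n) m - ∑ (λ i → seq (b i) M) (interval 0 n) ∣ ≤ frac n m + frac n M
partialSum-approx b zero m M =
  ≤-trans (≤-reflexive (QP.∣-∣-cong (QP.+-inverseʳ 0ℚᵘ))) (nonneg-+ (frac-nonneg 0 m) (frac-nonneg 0 M))
partialSum-approx b (suc n) m M = begin
  ∣ (P + c) - ∑ f (interval 0 (suc n)) ∣
    ≃⟨ QP.∣-∣-cong (QP.+-congʳ (P + c) (QP.-‿cong (∑-snoc f n))) ⟩
  ∣ (P + c) - (∑ f (interval 0 n) + f n) ∣
    ≤⟨ add-lemma P c (∑ f (interval 0 n)) (f n) ⟩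
  ∣ P - ∑ f (interval 0 n) ∣ + ∣ c - f n ∣
    ≤⟨ +-mono-≤ (partialSum-approx b n m₂ M) (reg (b n) m₂ M) ⟩
  (frac n m₂ + frac n M) + (inv m₂ + inv M)
    ≤⟨ +-mono-≤ (QP.+-monoˡ-≤ (frac n M) (frac-antitone n m≤m₂)) (QP.+-monoˡ-≤ (inv M) (frac-antitone 1 m≤m₂)) ⟩
  (frac n m + frac n M) + (inv m + inv M)
    ≃⟨ solve 4 (λ a b c d → (a :+ b) :+ (c :+ d) := (c :+ a) :+ (d :+ b)) ≃-refl
             (frac n m) (frac n M) (inv m) (inv M) ⟩
  (inv m + frac n m) + (inv M + frac n M)
    ≃⟨ QP.+-cong (frac-+ 1 n m) (frac-+ 1 n M) ⟩
  frac (suc n) m + frac (suc n) M ∎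
  where
  -- Bishop's sum evaluates both summands at index 2m+1
  m₂ = suc (2 N.* m)
  m≤m₂ : m N.≤ m₂
  m≤m₂ = NP.≤-trans (NP.m≤n*m m 2) (NP.n≤1+n _)
  f = λ i → seq (b i) M
  P = seq (partialSum b n) m₂
  c = seq (b n) m₂

limitError : ℕ → ℕ
limitError n = (n N.+ n) N.+ 5

limitError-mono : ∀ {m n} → m N.≤ n → limitError m N.≤ limitError n
limitError-mono m≤n = NP.+-monoˡ-≤ 5 (NP.+-mono-≤ m≤n m≤n)

partialSum-near-limit : ∀ (b : ℕ → ℝ) L c n → ∣ partialSum b n -ᵣ L ∣ᵣ ≤ᵣ (c *) →
  ∀ M → ∣ ∑ (λ i → seq (b i) M) (interval 0 n) - seq L M ∣ ≤ c + frac (limitError n) M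
partialSum-near-limit b L c n close M = begin
  ∣ S - seq L M ∣                         ≤⟨ dist-triangle S P (seq L M) ⟩
  ∣ S - P ∣ + ∣ P - seq L M ∣             ≤⟨ +-mono-≤ (≤-trans (≤-reflexive (dist-sym S P))
                                                                (partialSum-approx b n M M))
                                                      (dist-≤ℚ (partialSum b n) L c close M) ⟩
  (frac n M + frac n M) + (c + frac 5 M)
    ≃⟨ solve 3 (λ a c f → (a :+ a) :+ (c :+ f) := c :+ ((a :+ a) :+ f)) ≃-refl (frac n M) c (frac 5 M) ⟩
  c + ((frac n M + frac n M) + frac 5 M)
    ≃⟨ QP.+-congʳ c (≃-trans (QP.+-congˡ (frac 5 M) (frac-+ n n M)) (frac-+ (n N.+ n) 5 M)) ⟩
  c + frac (limitError n) M               ∎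
  where
  S = ∑ (λ i → seq (b i) M) (interval 0 n)
  P = seq (partialSum b n) M

cauchyError : ℕ → ℕ
cauchyError n = limitError n N.+ limitError n

cauchyError-mono : ∀ {m n} → m N.≤ n → cauchyError m N.≤ cauchyError n
cauchyError-mono m≤n = NP.+-mono-≤ (limitError-mono m≤n) (limitError-mono m≤n)

series-cauchy : ∀ (b : ℕ → ℝ) → SeriesConverges b → ∀ K → ∃ λ N₀ → ∀ n k M → N₀ N.≤ n →
  ∣ ∑ (λ i → seq (b i) M) (interval n k) ∣ ≤ (inv K + inv K) + frac (cauchyError (n N.+ k)) M
series-cauchy b (L , converges) K = N₀ , block-small
  where
  N₀ = proj₁ (converges K)
  close = proj₂ (converges K)
  block-small : ∀ n k M → N₀ N.≤ n →
    ∣ ∑ (λ i → seq (b i) M) (interval n k) ∣ ≤ (inv K + inv K) + frac (cauchyError (n N.+ k)) M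
  block-small n k M N₀≤n = begin
    ∣ X ∣                   ≃⟨ QP.∣-∣-cong X≃S'-S ⟩
    ∣ S' - S ∣              ≤⟨ dist-triangle S' LM S ⟩
    ∣ S' - LM ∣ + ∣ LM - S ∣
      ≤⟨ +-mono-≤ near' (≤-trans (≤-reflexive (dist-sym LM S))
                                 (≤-trans near (QP.+-monoʳ-≤ (inv K)
                                     (frac-mono M (limitError-mono (NP.m≤m+n n k)))))) ⟩
    (inv K + frac e M) + (inv K + frac e M)
      ≃⟨ solve 2 (λ i f → (i :+ f) :+ (i :+ f) := (i :+ i) :+ (f :+ f)) ≃-refl (inv K) (frac e M) ⟩
    (inv K + inv K) + (frac e M + frac e M)
      ≃⟨ QP.+-congʳ (inv K + inv K) (frac-+ e e M) ⟩
    (inv K + inv K) + frac (cauchyError (n N.+ k)) M ∎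
    where
    f = λ i → seq (b i) M
    S = ∑ f (interval 0 n)
    S' = ∑ f (interval 0 (n N.+ k))
    X = ∑ f (interval n k)
    LM = seq L M
    e = limitError (n N.+ k)
    -- the block is the difference of two partial sums, both close to the limit
    X≃S'-S : X ≃ S' - S
    X≃S'-S = ≃-trans (solve 2 (λ a x → x := (a :+ x) :- a) ≃-refl S X)
      (QP.+-congˡ (- S) (≃-sym (≃-trans (QP.≃-reflexive (cong (∑ f) (interval-++ 0 n k)))
                                        (∑-++ f (interval 0 n) (interval n k)))))
    near' : ∣ S' - LM ∣ ≤ inv K + frac e M
    near' = partialSum-near-limit b L (inv K) (n N.+ k) (close (n N.+ k) (NP.≤-trans N₀≤n (NP.m≤m+n n k))) M
    near : ∣ S - LM ∣ ≤ inv K + frac (limitError n) M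
    near = partialSum-near-limit b L (inv K) n (close n N₀≤n) M

∈-interval⁻ : ∀ {i} u n → i ∈ interval u n → (u N.≤ i) × (i N.< u N.+ n)
∈-interval⁻ u (suc n) (here refl) =
  NP.≤-refl , NP.≤-trans (NP.n<1+n u) (subst (suc u N.≤_) (sym (NP.+-suc u n)) (N.s≤s (NP.m≤m+n u n)))
∈-interval⁻ {i} u (suc n) (there i∈) with ∈-interval⁻ (suc u) n i∈
... | u<i , i<end = NP.≤-trans (NP.n≤1+n u) u<i , subst (i N.<_) (sym (NP.+-suc u n)) i<end

∈-interval⁺ : ∀ {i} u n → u N.≤ i → i N.< u N.+ n → i ∈ interval u n
∈-interval⁺ {i} u zero    u≤i i<u+0 =
  ⊥-elim (NP.<-irrefl refl (NP.<-≤-trans i<u+0 (subst (N._≤ i) (sym (NP.+-identityʳ u)) u≤i)))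
∈-interval⁺ {i} u (suc n) u≤i i<end with u N.≟ i
... | yes refl = here refl
... | no u≢i   = there (∈-interval⁺ (suc u) n (NP.≤∧≢⇒< u≤i u≢i) (subst (i N.<_) (NP.+-suc u n) i<end))

interval-unique : ∀ u n → Unique (interval u n)
interval-unique u zero    = []
interval-unique u (suc n) =
  All.tabulate (λ i∈ u≡i → NP.<-irrefl u≡i (proj₁ (∈-interval⁻ (suc u) n i∈))) ∷ interval-unique (suc u) n

at : List ℕ → ℕ → ℕ
at []       j       = 0
at (x ∷ xs) zero    = x
at (x ∷ xs) (suc j) = at xs j

position : List ℕ → ℕ → ℕ
position []       i = 0
position (x ∷ xs) i with x N.≟ i
... | yes _ = 0
... | no _  = suc (position xs i)

at-position : ∀ xs {i} → i ∈ xs → at xs (position xs i) ≡ i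
at-position (x ∷ xs) {i} i∈ with x N.≟ i
... | yes x≡i = x≡i
at-position (x ∷ xs) (here i≡x)  | no x≢i = ⊥-elim (x≢i (sym i≡x))
at-position (x ∷ xs) (there i∈) | no _   = at-position xs i∈

position-< : ∀ xs {i} → i ∈ xs → position xs i N.< length xs
position-< (x ∷ xs) {i} i∈ with x N.≟ i
... | yes _ = N.s≤s N.z≤n
position-< (x ∷ xs) (here i≡x)  | no x≢i = ⊥-elim (x≢i (sym i≡x))
position-< (x ∷ xs) (there i∈) | no _   = N.s≤s (position-< xs i∈)

at-∈ : ∀ xs {j} → j N.< length xs → at xs j ∈ xs
at-∈ (x ∷ xs) {zero}  _            = here refl
at-∈ (x ∷ xs) {suc j} (N.s≤s j<) = there (at-∈ xs j<)

position-at : ∀ {xs} j → Unique xs → j N.< length xs → position xs (at xs j) ≡ j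
position-at {x ∷ xs} zero    _ _ with x N.≟ x
... | yes _  = refl
... | no x≢x = ⊥-elim (x≢x refl)
position-at {x ∷ xs} (suc j) (x∉xs ∷ xs!) (N.s≤s j<) with x N.≟ at xs j
... | yes x≡ = ⊥-elim (All.lookup x∉xs (at-∈ xs j<) x≡)
... | no _   = cong suc (position-at j xs! j<)

at-++ˡ : ∀ xs ys {j} → j N.< length xs → at (xs ++ ys) j ≡ at xs j
at-++ˡ (x ∷ xs) ys {zero}  _           = refl
at-++ˡ (x ∷ xs) ys {suc j} (N.s≤s j<) = at-++ˡ xs ys j<

at-++ʳ : ∀ xs ys j → at (xs ++ ys) (length xs N.+ j) ≡ at ys j
at-++ʳ []       ys j = refl
at-++ʳ (x ∷ xs) ys j = at-++ʳ xs ys j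

map-interval-at : ∀ zs off (g : ℕ → ℕ) → (∀ j → j N.< length zs → g (off N.+ j) ≡ at zs j) →
  map g (interval off (length zs)) ≡ zs
map-interval-at []       off g h = refl
map-interval-at (z ∷ zs) off g h =
  cong₂ _∷_
    (trans (cong g (sym (NP.+-identityʳ off))) (h 0 (N.s≤s N.z≤n)))
    (map-interval-at zs (suc off) g λ j j< → trans (cong g (sym (NP.+-suc off j))) (h (suc j) (N.s≤s j<)))

module SignSort (g : ℕ → ℚᵘ) where
  nonneg? : Decidable (λ i → 0ℚᵘ ≤ g i)
  nonneg? i = 0ℚᵘ QP.≤? g i

  neg? : Decidable (λ i → ¬ (0ℚᵘ ≤ g i))
  neg? i = ¬? (nonneg? i)

  nonnegs negs signSorted : List ℕ → List ℕ
  nonnegs    = filter nonneg?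
  negs       = filter neg?
  signSorted xs = nonnegs xs ++ negs xs

  filters-nonneg : ∀ {x} xs → 0ℚᵘ ≤ g x → (nonnegs (x ∷ xs) ≡ x ∷ nonnegs xs) × (negs (x ∷ xs) ≡ negs xs)
  filters-nonneg xs g≥0 = LP.filter-accept nonneg? g≥0 , LP.filter-reject neg? (λ g<0 → g<0 g≥0)

  filters-neg : ∀ {x} xs → ¬ (0ℚᵘ ≤ g x) → (nonnegs (x ∷ xs) ≡ nonnegs xs) × (negs (x ∷ xs) ≡ x ∷ negs xs)
  filters-neg xs g<0 = LP.filter-reject nonneg? g<0 , LP.filter-accept neg? g<0

  length-signSorted : ∀ xs → length (nonnegs xs) N.+ length (negs xs) ≡ length xs
  length-signSorted []       = refl
  length-signSorted (x ∷ xs) with nonneg? x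
  ... | yes g≥0 rewrite proj₁ (filters-nonneg xs g≥0) | proj₂ (filters-nonneg xs g≥0) =
    cong suc (length-signSorted xs)
  ... | no g<0 rewrite proj₁ (filters-neg xs g<0) | proj₂ (filters-neg xs g<0) =
    trans (NP.+-suc _ _) (cong suc (length-signSorted xs))

  signSorted-unique : ∀ {xs} → Unique xs → Unique (signSorted xs)
  signSorted-unique {xs} xs! = Unique.++⁺ (Unique.filter⁺ nonneg? xs!) (Unique.filter⁺ neg? xs!)
    λ (i∈₁ , i∈₂) → proj₂ (∈-filter⁻ neg? {xs = xs} i∈₂) (proj₂ (∈-filter⁻ nonneg? {xs = xs} i∈₁))

  ∈-signSorted⁻ : ∀ xs {i} → i ∈ signSorted xs → i ∈ xs
  ∈-signSorted⁻ xs i∈ with ∈-++⁻ (nonnegs xs) i∈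
  ... | inj₁ i∈₁ = proj₁ (∈-filter⁻ nonneg? i∈₁)
  ... | inj₂ i∈₂ = proj₁ (∈-filter⁻ neg? i∈₂)

  ∈-signSorted⁺ : ∀ xs {i} → i ∈ xs → i ∈ signSorted xs
  ∈-signSorted⁺ xs {i} i∈ with nonneg? i
  ... | yes g≥0 = ∈-++⁺ˡ (∈-filter⁺ nonneg? i∈ g≥0)
  ... | no g<0  = ∈-++⁺ʳ (nonnegs xs) (∈-filter⁺ neg? i∈ g<0)

  ∑-abs-by-sign : ∀ xs → ∑ (λ i → ∣ g i ∣) xs ≃ ∑ g (nonnegs xs) - ∑ g (negs xs)
  ∑-abs-by-sign []       = ≃-refl
  ∑-abs-by-sign (x ∷ xs) with nonneg? x
  ... | yes g≥0 rewrite proj₁ (filters-nonneg xs g≥0) | proj₂ (filters-nonneg xs g≥0) =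
    ≃-trans (QP.+-cong (QP.0≤p⇒∣p∣≃p g≥0) (∑-abs-by-sign xs))
      (solve 3 (λ a b c → a :+ (b :- c) := (a :+ b) :- c) ≃-refl (g x) (∑ g (nonnegs xs)) (∑ g (negs xs)))
  ... | no g<0 rewrite proj₁ (filters-neg xs g<0) | proj₂ (filters-neg xs g<0) =
    ≃-trans (QP.+-cong ∣g∣≃-g (∑-abs-by-sign xs))
      (solve 3 (λ a b c → (:- a) :+ (b :- c) := b :- (a :+ c)) ≃-refl (g x) (∑ g (nonnegs xs)) (∑ g (negs xs)))
    where
    ∣g∣≃-g : ∣ g x ∣ ≃ - g x
    ∣g∣≃-g with QP.∣p∣≡p∨∣p∣≡-p (g x)
    ... | inj₁ eq = ⊥-elim (g<0 (QP.∣p∣≡p⇒0≤p eq))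
    ... | inj₂ eq = QP.≃-reflexive eq

record Enumerates (xs : List ℕ) (u t : ℕ) : Set where
  field
    unique  : Unique xs
    length≡ : length xs ≡ t N.∸ u
    ∈⁻      : ∀ {i} → i ∈ xs → (u N.≤ i) × (i N.< t)
    ∈⁺      : ∀ {i} → u N.≤ i → i N.< t → i ∈ xs

module BlockPermutation
  (block     : ℕ → Maybe (ℕ × ℕ))
  (order     : ℕ → ℕ → List ℕ)
  (enumerate : ∀ {k u t} → block k ≡ just (u , t) → Enumerates (order u t) u t)
  (late      : ∀ {k u t} → block k ≡ just (u , t) → k N.< u)
  (ordered   : ∀ {k k' u t u' t'} → block k ≡ just (u , t) → block k' ≡ just (u' , t') →
               k N.< k' → t N.≤ u')
  where

  record InBlock (i u t : ℕ) : Set where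
    field
      stage : ℕ
      chosen : block stage ≡ just (u , t)
      u≤i : u N.≤ i
      i<t : i N.< t
  open InBlock

  -- blocks are disjoint, so i lies in at most one of them
  inBlock-unique : ∀ {i u t u' t'} → InBlock i u t → InBlock i u' t' → (u , t) ≡ (u' , t')
  inBlock-unique A B with NP.<-cmp (stage A) (stage B)
  ... | tri< lt _ _ = ⊥-elim (NP.<-irrefl refl (NP.<-≤-trans (i<t A)
          (NP.≤-trans (ordered (chosen A) (chosen B) lt) (u≤i B))))
  ... | tri> _ _ gt = ⊥-elim (NP.<-irrefl refl (NP.<-≤-trans (i<t B)
          (NP.≤-trans (ordered (chosen B) (chosen A) gt) (u≤i A))))
  ... | tri≈ _ eq _ = just-injective (trans (sym (chosen A)) (trans (cong block eq) (chosen B)))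
    where
    just-injective : ∀ {x y : ℕ × ℕ} → just x ≡ just y → x ≡ y
    just-injective refl = refl

  containing : ℕ → Maybe (ℕ × ℕ) → Maybe (ℕ × ℕ)
  containing i nothing = nothing
  containing i (just (u , t)) with u N.≤? i | i N.<? t
  ... | yes _ | yes _ = just (u , t)
  ... | _     | _     = nothing

  containing-just : ∀ i m {u t} → containing i m ≡ just (u , t) → (m ≡ just (u , t)) × (u N.≤ i) × (i N.< t)
  containing-just i (just (u , t)) e with u N.≤? i | i N.<? t
  containing-just i (just (u , t)) refl | yes u≤i | yes i<t = refl , u≤i , i<t

  containing-yes : ∀ i {u t} → u N.≤ i → i N.< t → containing i (just (u , t)) ≡ just (u , t)
  containing-yes i {u} {t} u≤i i<t with u N.≤? i | i N.<? t
  ... | yes _   | yes _   = refl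
  ... | no u≰i  | _       = ⊥-elim (u≰i u≤i)
  ... | yes _   | no i≮t  = ⊥-elim (i≮t i<t)

  search : ℕ → ℕ → Maybe (ℕ × ℕ)
  search i zero    = nothing
  search i (suc n) = search i n <∣> containing i (block n)

  search-sound : ∀ i n {u t} → search i n ≡ just (u , t) → InBlock i u t
  search-sound i (suc n) e with search i n in e₀
  ... | just _  = search-sound i n (trans e₀ e)
  ... | nothing with containing-just i (block n) e
  ...   | ch , u≤i , i<t = record { stage = n ; chosen = ch ; u≤i = u≤i ; i<t = i<t }

  search-complete : ∀ i n {u t} (A : InBlock i u t) → stage A N.< n → search i n ≡ just (u , t)
  search-complete i (suc n) A lt with search i n in e₀
  ... | just _ = cong just (sym (inBlock-unique A (search-sound i n e₀)))
  ... | nothing with NP.m≤n⇒m<n∨m≡n (NP.≤-pred lt)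
  ...   | inj₁ lt' with trans (sym (search-complete i n A lt')) e₀
  ...     | ()
  search-complete i (suc n) A lt | nothing | inj₂ refl =
    trans (cong (containing i) (chosen A)) (containing-yes i (u≤i A) (i<t A))

  -- a block containing i is introduced before stage i, so this finds it
  blockOf : ℕ → Maybe (ℕ × ℕ)
  blockOf i = search i i

  blockOf-complete : ∀ {i u t} (A : InBlock i u t) → blockOf i ≡ just (u , t)
  blockOf-complete {i} A = search-complete i i A (NP.<-≤-trans (late (chosen A)) (u≤i A))

  to-within : ℕ → Maybe (ℕ × ℕ) → ℕ
  to-within i (just (u , t)) = at (order u t) (i N.∸ u)
  to-within i nothing        = i

  from-within : ℕ → Maybe (ℕ × ℕ) → ℕ
  from-within i (just (u , t)) = u N.+ position (order u t) i
  from-within i nothing        = i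

  to from : ℕ → ℕ
  to i   = to-within i (blockOf i)
  from i = from-within i (blockOf i)

  same-block : ∀ {i u t z} → InBlock i u t → u N.≤ z → z N.< t → InBlock z u t
  same-block A u≤z z<t = record { stage = stage A ; chosen = chosen A ; u≤i = u≤z ; i<t = z<t }

  offset-< : ∀ {u j t} → j N.< t N.∸ u → u N.+ j N.< t
  offset-< {u} {j} {t} j< = subst (u N.+ j N.<_) (NP.m+[n∸m]≡n u≤t) (NP.+-monoʳ-< u j<)
    where
    u≤t : u N.≤ t
    u≤t = NP.<⇒≤ (NP.m∸n≢0⇒n<m (λ t∸u≡0 → NP.n≮0 (subst (j N.<_) t∸u≡0 j<)))

  to-in-block : ∀ {k u t} → block k ≡ just (u , t) → ∀ j → j N.< t N.∸ u → to (u N.+ j) ≡ at (order u t) j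
  to-in-block {k} {u} {t} ch j j< =
    trans (cong (to-within (u N.+ j)) (blockOf-complete A)) (cong (at (order u t)) (NP.m+n∸m≡n u j))
    where
    A : InBlock (u N.+ j) u t
    A = record { stage = k ; chosen = ch ; u≤i = NP.m≤m+n u j ; i<t = offset-< j< }

  to-from : ∀ y → to (from y) ≡ y
  to-from y with blockOf y in e
  ... | nothing = cong (to-within y) e
  ... | just (u , t) =
    trans (to-in-block (chosen A) p p<) (at-position (order u t) y∈)
    where
    A = search-sound y y e
    en = enumerate (chosen A)
    y∈ = Enumerates.∈⁺ en (u≤i A) (i<t A)
    p = position (order u t) y
    p< : p N.< t N.∸ u
    p< = subst (p N.<_) (Enumerates.length≡ en) (position-< (order u t) y∈)

  from-to : ∀ x → from (to x) ≡ x
  from-to x with blockOf x in e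
  ... | nothing = cong (from-within x) e
  ... | just (u , t) =
    trans (cong (from-within z) (blockOf-complete (same-block A (proj₁ z-in) (proj₂ z-in))))
          (trans (cong (u N.+_) (position-at j (Enumerates.unique en) j<)) (NP.m+[n∸m]≡n (u≤i A)))
    where
    A = search-sound x x e
    en = enumerate (chosen A)
    j = x N.∸ u
    j< : j N.< length (order u t)
    j< = subst (j N.<_) (sym (Enumerates.length≡ en)) (NP.∸-monoˡ-< (i<t A) (u≤i A))
    z = at (order u t) j
    z-in = Enumerates.∈⁻ en (at-∈ (order u t) j<)

  σ : ℕ ↔ ℕ
  σ = mk↔ₛ′ to from to-from from-to

nextPair : ℕ × ℕ → ℕ × ℕ
nextPair (x , t) with suc x N.<? t
... | yes _ = (suc x , t)
... | no _  = (0 , suc t)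

pair : ℕ → ℕ × ℕ
pair zero    = (0 , 1)
pair (suc k) = nextPair (pair k)

pair-onto-row : ∀ t x → x N.< suc t → ∃ λ k → pair k ≡ (x , suc t)
pair-onto-row zero    zero    _ = 0 , refl
pair-onto-row (suc t) zero    _ with pair-onto-row t t (NP.n<1+n t)
... | k , e = suc k , trans (cong nextPair e) last-in-row
  where
  last-in-row : nextPair (t , suc t) ≡ (0 , suc (suc t))
  last-in-row with suc t N.<? suc t
  ... | yes t+1<t+1 = ⊥-elim (NP.<-irrefl refl t+1<t+1)
  ... | no _        = refl
pair-onto-row t (suc x) x+1≤t with pair-onto-row t x (NP.<-trans (NP.n<1+n x) x+1≤t)
... | k , e = suc k , trans (cong nextPair e) next-in-row
  where
  next-in-row : nextPair (x , suc t) ≡ (suc x , suc t)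
  next-in-row with suc x N.<? suc t
  ... | yes _   = refl
  ... | no x+1≮ = ⊥-elim (x+1≮ x+1≤t)

pair-onto : ∀ {x t} → x N.< t → ∃ λ k → pair k ≡ (x , t)
pair-onto {x} {suc t} x<t = pair-onto-row t x x<t

countable-witnessed : (R : ℕ → ℕ → Set) → (∀ x t → Dec (R x t)) → (∀ {x t} → R x t → x N.< t) →
  Countable (λ x → (x ≡ 1) ⊎ ∃ (R x))
countable-witnessed R R? R⇒< = enum , enum-in , enum-onto
  where
  pick : ℕ × ℕ → ℕ
  pick (x , t) with R? x t
  ... | yes _ = x
  ... | no _  = 1

  pick-in : ∀ p → (pick p ≡ 1) ⊎ ∃ (R (pick p))
  pick-in (x , t) with R? x t
  ... | yes r = inj₂ (t , r)
  ... | no _  = inj₁ refl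

  pick-witness : ∀ {x t} → R x t → pick (x , t) ≡ x
  pick-witness {x} {t} r with R? x t
  ... | yes _  = refl
  ... | no ¬r = ⊥-elim (¬r r)

  enum : ℕ → ℕ
  enum zero    = 1
  enum (suc k) = pick (pair k)

  enum-in : ∀ k → (enum k ≡ 1) ⊎ ∃ (R (enum k))
  enum-in zero    = inj₁ refl
  enum-in (suc k) = pick-in (pair k)

  enum-onto : ∀ m → (m ≡ 1) ⊎ ∃ (R m) → ∃ λ k → enum k ≡ m
  enum-onto m (inj₁ m≡1) = 0 , sym m≡1
  enum-onto m (inj₂ (t , r)) with pair-onto (R⇒< r)
  ... | k , e = suc k , trans (cong pick e) (pick-witness r)

module TailBound (a : ℕ → ℝ) (E : ℕ) where

  precision : ℕ → ℕ
  precision t = cauchyError t N.* (4 N.* E N.+ 4)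

  t/precision≤ : ∀ t → frac t (precision t) ≤ inv E
  t/precision≤ t = frac-≤ {t} {precision t} {1} {E}
    (NP.≤-trans (NP.*-mono-≤ t≤C (NP.≤-trans (NP.m≤n*m (suc E) 4) (NP.≤-reflexive (4[E+1] E))))
                (NP.≤-trans (NP.n≤1+n _) (NP.≤-reflexive (sym (NP.*-identityˡ _)))))
    where
    t≤C : t N.≤ cauchyError t
    t≤C = NP.≤-trans (NP.m≤m+n t t) (NP.≤-trans (NP.m≤m+n (t N.+ t) 5) (NP.m≤m+n _ _))
    4[E+1] : ∀ E → 4 N.* suc E ≡ 4 N.* E N.+ 4
    4[E+1] = solve-∀

  term : ℕ → ℕ → ℚᵘ
  term t i = seq (a i) (precision t)

  blockAbs : ℕ → ℕ → ℚᵘ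
  blockAbs u t = ∑ (λ i → ∣ term t i ∣) (interval u (t N.∸ u))

  BigBlock : ℕ → ℕ → Set
  BigBlock x t = (0 N.< x) × (x N.< t) × (inv E < blockAbs x t)

  S : ℕ → Set
  S x = (x ≡ 1) ⊎ ∃ (BigBlock x)

  S-positive : SubsetOfℕ⁺ S
  S-positive m (inj₁ refl)            = N.s≤s N.z≤n
  S-positive m (inj₂ (_ , 0<m , _)) = 0<m

  S-countable : Countable S
  S-countable = countable-witnessed BigBlock
    (λ x t → (0 N.<? x) ×-dec (x N.<? t) ×-dec (inv E QP.<? blockAbs x t))
    (λ (_ , x<t , _) → x<t)

  reordered : ℕ → ℕ → List ℕ
  reordered u t = SignSort.signSorted (term t) (interval u (t N.∸ u))

  reordered-enumerates : ∀ {u t} → u N.≤ t → Enumerates (reordered u t) u t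
  reordered-enumerates {u} {t} u≤t = record
    { unique  = signSorted-unique (interval-unique u (t N.∸ u))
    ; length≡ = trans (LP.length-++ (nonnegs xs)) (trans (length-signSorted xs) (length-interval u (t N.∸ u)))
    ; ∈⁻      = λ i∈ → in-range (∈-interval⁻ u (t N.∸ u) (∈-signSorted⁻ xs i∈))
    ; ∈⁺      = λ {i} u≤i i<t → ∈-signSorted⁺ xs (∈-interval⁺ u (t N.∸ u) u≤i
                  (subst (i N.<_) (sym (NP.m+[n∸m]≡n u≤t)) i<t))
    }
    where
    open SignSort (term t)
    xs = interval u (t N.∸ u)
    in-range : ∀ {i} → (u N.≤ i) × (i N.< u N.+ (t N.∸ u)) → (u N.≤ i) × (i N.< t)
    in-range {i} (u≤i , i<) = u≤i , subst (i N.<_) (NP.m+[n∸m]≡n u≤t) i<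

  K : ℕ
  K = 8 N.* E N.+ 7

  -- Two Cauchy estimates for blocks ending at or before t add up to at most
  -- 1/(E+1): this is what the choice of K and of the precision is for.
  two-estimates-≤ : ∀ c t → c N.≤ cauchyError t →
    ((inv K + inv K) + frac c (precision t)) + ((inv K + inv K) + frac (cauchyError t) (precision t)) ≤ inv E
  two-estimates-≤ c t c≤ = begin
    ((inv K + inv K) + frac c M) + ((inv K + inv K) + frac C M)
      ≤⟨ QP.+-monoˡ-≤ ((inv K + inv K) + frac C M) (QP.+-monoʳ-≤ (inv K + inv K) (frac-mono M c≤)) ⟩
    ((inv K + inv K) + frac C M) + ((inv K + inv K) + frac C M)
      ≃⟨ solve 2 (λ i f → ((i :+ i) :+ f) :+ ((i :+ i) :+ f) := ((i :+ i) :+ (i :+ i)) :+ (f :+ f))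
               ≃-refl (inv K) (frac C M) ⟩
    ((inv K + inv K) + (inv K + inv K)) + (frac C M + frac C M)
      ≃⟨ QP.+-cong (≃-trans (QP.+-cong (frac-+ 1 1 K) (frac-+ 1 1 K)) (frac-+ 2 2 K)) (frac-+ C C M) ⟩
    frac 4 K + frac (C N.+ C) M
      ≤⟨ +-mono-≤ (frac-≤ {4} {K} {1} {2 N.* E N.+ 1} (NP.≤-reflexive (4/K E)))
                  (frac-≤ {C N.+ C} {M} {1} {2 N.* E N.+ 1}
                     (NP.≤-trans (NP.≤-reflexive (2C/M C E)) (NP.n≤1+n _))) ⟩
    frac 1 (2 N.* E N.+ 1) + frac 1 (2 N.* E N.+ 1)
      ≃⟨ frac-+ 1 1 (2 N.* E N.+ 1) ⟩
    frac 2 (2 N.* E N.+ 1)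
      ≤⟨ frac-≤ {2} {2 N.* E N.+ 1} {1} {E} (NP.≤-reflexive (halves E)) ⟩
    inv E ∎
    where
    C = cauchyError t
    M = precision t
    4/K : ∀ E → 4 N.* suc (2 N.* E N.+ 1) ≡ 1 N.* suc (8 N.* E N.+ 7)
    4/K = solve-∀
    2C/M : ∀ C E → (C N.+ C) N.* suc (2 N.* E N.+ 1) ≡ 1 N.* (C N.* (4 N.* E N.+ 4))
    2C/M = solve-∀
    halves : ∀ E → 2 N.* suc E ≡ 1 N.* suc (2 N.* E N.+ 1)
    halves = solve-∀

  small-parts : ∀ u t c → c N.≤ cauchyError t →
    let open SignSort (term t) ; xs = interval u (t N.∸ u) in
    ∣ ∑ (term t) (nonnegs xs) ∣ ≤ (inv K + inv K) + frac c (precision t) →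
    ∣ ∑ (term t) (negs xs) ∣ ≤ (inv K + inv K) + frac (cauchyError t) (precision t) →
    blockAbs u t ≤ inv E
  small-parts u t c c≤ bound⁺ bound⁻ = begin
    blockAbs u t   ≃⟨ ∑-abs-by-sign xs ⟩
    P - N          ≤⟨ p≤∣p∣ (P - N) ⟩
    ∣ P - N ∣      ≤⟨ QP.∣p-q∣≤∣p∣+∣q∣ P N ⟩
    ∣ P ∣ + ∣ N ∣  ≤⟨ +-mono-≤ bound⁺ bound⁻ ⟩
    ((inv K + inv K) + frac c (precision t)) + ((inv K + inv K) + frac (cauchyError t) (precision t))
                   ≤⟨ two-estimates-≤ c t c≤ ⟩
    inv E          ∎
    where
    open SignSort (term t)
    xs = interval u (t N.∸ u)
    P = ∑ (term t) (nonnegs xs)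
    N = ∑ (term t) (negs xs)

  select : ℕ → ℕ → (x : ℕ) → S x → Maybe (ℕ × ℕ)
  select k f x (inj₁ _) = nothing
  select k f x (inj₂ (t , _)) with k N.<? x | f N.≤? x
  ... | yes _ | yes _ = just (x , t)
  ... | _     | _     = nothing

  record Selected (k f u t : ℕ) : Set where
    field
      k<u : k N.< u
      f≤u : f N.≤ u
      big : BigBlock u t

  select-sound : ∀ k f x (x∈ : S x) {u t} → select k f x x∈ ≡ just (u , t) → Selected k f u t
  select-sound k f x (inj₁ _) ()
  select-sound k f x (inj₂ (t , big)) e with k N.<? x | f N.≤? x | e
  ... | yes k<x | yes f≤x | refl = record { k<u = k<x ; f≤u = f≤x ; big = big }
  ... | yes _   | no _    | ()
  ... | no _    | _       | ()

  select-complete : ∀ k f x t (big : BigBlock x t) → k N.< x → f N.≤ x →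
    select k f x (inj₂ (t , big)) ≡ just (x , t)
  select-complete k f x t big k<x f≤x with k N.<? x | f N.≤? x
  ... | yes _  | yes _  = refl
  ... | no k≮x | _      = ⊥-elim (k≮x k<x)
  ... | yes _  | no f≰x = ⊥-elim (f≰x f≤x)

  advance : ℕ → Maybe (ℕ × ℕ) → ℕ
  advance f nothing        = f
  advance f (just (u , t)) = t

  module Greedy (s : ℕ → ℕ) (s∈S : ∀ k → S (s k)) where
    frontier : ℕ → ℕ
    frontier zero    = 0
    frontier (suc k) = advance (frontier k) (select k (frontier k) (s k) (s∈S k))

    chosen : ℕ → Maybe (ℕ × ℕ)
    chosen k = select k (frontier k) (s k) (s∈S k)

    chosen-selected : ∀ {k u t} → chosen k ≡ just (u , t) → Selected k (frontier k) u t
    chosen-selected {k} = select-sound k (frontier k) (s k) (s∈S k)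

    chosen-u<t : ∀ {k u t} → chosen k ≡ just (u , t) → u N.< t
    chosen-u<t ch = proj₁ (proj₂ (Selected.big (chosen-selected ch)))

    frontier-step : ∀ k → frontier k N.≤ frontier (suc k)
    frontier-step k with chosen k in ch
    ... | nothing      = NP.≤-refl
    ... | just (u , t) = NP.≤-trans (Selected.f≤u (chosen-selected ch)) (NP.<⇒≤ (chosen-u<t ch))

    frontier-mono : ∀ {k k'} → k N.≤ k' → frontier k N.≤ frontier k'
    frontier-mono {k} {k'} k≤k' = subst (λ z → frontier k N.≤ frontier z) (NP.m+[n∸m]≡n k≤k') (go (k' N.∸ k))
      where
      go : ∀ d → frontier k N.≤ frontier (k N.+ d)
      go zero    = NP.≤-reflexive (cong frontier (sym (NP.+-identityʳ k)))
      go (suc d) = NP.≤-trans (go d)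
        (NP.≤-trans (frontier-step (k N.+ d)) (NP.≤-reflexive (cong frontier (sym (NP.+-suc k d)))))

    -- a later block starts beyond the frontier, hence after every earlier block
    chosen-ordered : ∀ {k k' u t u' t'} → chosen k ≡ just (u , t) → chosen k' ≡ just (u' , t') →
      k N.< k' → t N.≤ u'
    chosen-ordered {k} ch ch' k<k' =
      NP.≤-trans (NP.≤-reflexive (sym (cong (advance (frontier k)) ch)))
        (NP.≤-trans (frontier-mono k<k') (Selected.f≤u (chosen-selected ch')))

    open BlockPermutation chosen reordered
      (λ ch → reordered-enumerates (NP.<⇒≤ (chosen-u<t ch)))
      (λ ch → Selected.k<u (chosen-selected ch))
      chosen-ordered
      public

    module OnBlock {k u t} (ch : chosen k ≡ just (u , t)) where
      open SignSort (term t) public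
      xs = interval u (t N.∸ u)
      r⁺ = length (nonnegs xs)
      r⁻ = length (negs xs)

      lengths : r⁺ N.+ r⁻ ≡ t N.∸ u
      lengths = trans (length-signSorted xs) (length-interval u (t N.∸ u))

      ends-at-t : (u N.+ r⁺) N.+ r⁻ ≡ t
      ends-at-t = trans (NP.+-assoc u r⁺ r⁻)
        (trans (cong (u N.+_) lengths) (NP.m+[n∸m]≡n (NP.<⇒≤ (chosen-u<t ch))))

      nonneg-first : map to (interval u r⁺) ≡ nonnegs xs
      nonneg-first = map-interval-at (nonnegs xs) u to λ j j< →
        trans (to-in-block ch j (subst (j N.<_) lengths (NP.<-≤-trans j< (NP.m≤m+n r⁺ r⁻))))
              (at-++ˡ (nonnegs xs) (negs xs) j<)

      neg-second : map to (interval (u N.+ r⁺) r⁻) ≡ negs xs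
      neg-second = map-interval-at (negs xs) (u N.+ r⁺) to λ j j< →
        trans (cong to (NP.+-assoc u r⁺ j))
          (trans (to-in-block ch (r⁺ N.+ j) (subst (r⁺ N.+ j N.<_) lengths (NP.+-monoʳ-< r⁺ j<)))
                 (at-++ʳ (nonnegs xs) (negs xs) j))

    module BeyondModulus (N₀ : ℕ)
      (cauchy : ∀ n k M → N₀ N.≤ n →
        ∣ ∑ (λ i → seq (a (to i)) M) (interval n k) ∣ ≤ (inv K + inv K) + frac (cauchyError (n N.+ k)) M)
      where

      -- both parts of a late selected block are far-out blocks of the
      -- rearranged series, so the block is not big after all
      no-late-block : ∀ {k u t} → chosen k ≡ just (u , t) → N₀ N.≤ k → ⊥
      no-late-block {k} {u} {t} ch N₀≤k =
        QP.<⇒≱ (proj₂ (proj₂ (Selected.big sel))) (small-parts u t (cauchyError (u N.+ r⁺)) c≤C bound⁺ bound⁻)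
        where
        open OnBlock ch
        sel = chosen-selected ch
        M = precision t
        N₀≤u : N₀ N.≤ u
        N₀≤u = NP.≤-trans N₀≤k (NP.<⇒≤ (Selected.k<u sel))
        c≤C : cauchyError (u N.+ r⁺) N.≤ cauchyError t
        c≤C = subst (λ e → cauchyError (u N.+ r⁺) N.≤ cauchyError e) ends-at-t
                    (cauchyError-mono (NP.m≤m+n (u N.+ r⁺) r⁻))
        part⁺ : ∑ (λ i → seq (a (to i)) M) (interval u r⁺) ≡ ∑ (term t) (nonnegs xs)
        part⁺ = trans (sym (∑-map (term t) to (interval u r⁺))) (cong (∑ (term t)) nonneg-first)
        part⁻ : ∑ (λ i → seq (a (to i)) M) (interval (u N.+ r⁺) r⁻) ≡ ∑ (term t) (negs xs)
        part⁻ = trans (sym (∑-map (term t) to (interval (u N.+ r⁺) r⁻))) (cong (∑ (term t)) neg-second)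
        bound⁺ : ∣ ∑ (term t) (nonnegs xs) ∣ ≤ (inv K + inv K) + frac (cauchyError (u N.+ r⁺)) M
        bound⁺ = subst (λ X → ∣ X ∣ ≤ (inv K + inv K) + frac (cauchyError (u N.+ r⁺)) M) part⁺
                       (cauchy u r⁺ M N₀≤u)
        bound⁻ : ∣ ∑ (term t) (negs xs) ∣ ≤ (inv K + inv K) + frac (cauchyError t) M
        bound⁻ = subst₂ (λ X e → ∣ X ∣ ≤ (inv K + inv K) + frac (cauchyError e) M) part⁻ ends-at-t
                        (cauchy (u N.+ r⁺) r⁻ M (NP.≤-trans N₀≤u (NP.m≤m+n u r⁺)))

      -- from stage N₀ on nothing is selected, so the frontier stays put
      frontier-stable : ∀ d → frontier (N₀ N.+ d) ≡ frontier N₀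
      frontier-stable zero    = cong frontier (NP.+-identityʳ N₀)
      frontier-stable (suc d) with chosen (N₀ N.+ d) in ch
      ... | just _  = ⊥-elim (no-late-block ch (NP.m≤m+n N₀ d))
      ... | nothing = trans (cong frontier (NP.+-suc N₀ d))
                            (trans (cong (advance (frontier (N₀ N.+ d))) ch) (frontier-stable d))

      -- an element s k > k with k beyond N₀ and the frontier would be selected
      eventually-below : ∀ k → suc (N₀ N.+ frontier N₀) N.≤ k → s k N.< suc k
      eventually-below k late with s k N.≤? k
      ... | yes sk≤k = N.s≤s sk≤k
      ... | no sk≰k with s∈S k in s∈
      ...   | inj₁ sk≡1 = ⊥-elim (sk≰k (subst (N._≤ k) (sym sk≡1) (NP.≤-trans (N.s≤s N.z≤n) late)))
      ...   | inj₂ (t , big) = ⊥-elim (no-late-block ch N₀≤k)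
        where
        N₀≤k : N₀ N.≤ k
        N₀≤k = NP.≤-trans (NP.m≤m+n N₀ (frontier N₀)) (NP.≤-trans (NP.n≤1+n _) late)
        frontier≤sk : frontier k N.≤ s k
        frontier≤sk = subst (N._≤ s k)
          (sym (trans (cong frontier (sym (NP.m+[n∸m]≡n N₀≤k))) (frontier-stable (k N.∸ N₀))))
          (NP.≤-trans (NP.m≤n+m (frontier N₀) N₀) (NP.≤-trans (NP.n≤1+n _) (NP.≤-trans late (NP.<⇒≤ (NP.≰⇒> sk≰k)))))
        ch : chosen k ≡ just (s k , t)
        ch = trans (cong (select k (frontier k) (s k)) s∈)
                   (select-complete k (frontier k) (s k) t big (NP.≰⇒> sk≰k) frontier≤sk)

  -- the rearrangement of a along a sequence in S converges, so eventually
  -- nothing is selected and the sequence stays below its index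
  S-pseudobounded : PermutablyConvergent a → Pseudobounded S
  S-pseudobounded pc s s∈S = suc (N₀ N.+ frontier N₀) , BeyondModulus.eventually-below N₀ cauchy
    where
    open Greedy s s∈S
    rearranged-cauchy = series-cauchy (λ n → a (to n)) (pc σ) K
    N₀ = proj₁ rearranged-cauchy
    cauchy = proj₂ rearranged-cauchy

  -- By BD-ℕ the set S is bounded; blocks beyond the bound are not big.
  small-blocks : BD-ℕ → PermutablyConvergent a → ∃ λ N → ∀ t → blockAbs N t ≤ inv E
  small-blocks bd pc = suc B , λ t → not-big t (suc B N.<? t) (inv E QP.<? blockAbs (suc B) t)
    where
    S-bounded = bd S S-positive (1 , inj₁ refl) S-countable (S-pseudobounded pc)
    B = proj₁ S-bounded
    not-big : ∀ t → Dec (suc B N.< t) → Dec (inv E < blockAbs (suc B) t) → blockAbs (suc B) t ≤ inv E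
    not-big t (yes B<t) (yes big) =
      ⊥-elim (NP.<-irrefl refl (proj₂ S-bounded (suc B) (inj₂ (t , N.s≤s N.z≤n , B<t , big))))
    not-big t (yes _)   (no ¬big) = QP.≮⇒≥ ¬big
    not-big t (no B≮t)  _         = subst (λ n → ∑ (λ i → ∣ term t i ∣) (interval (suc B) n) ≤ inv E)
                                      (sym (NP.m≤n⇒m∸n≡0 (NP.≮⇒≥ B≮t))) (frac-nonneg 1 E)

  small-tails : BD-ℕ → PermutablyConvergent a →
    ∃ λ N → ∀ t M → ∑ (λ i → ∣ seq (a i) M ∣) (interval N (t N.∸ N)) ≤ frac 2 E + frac t M
  small-tails bd pc = N , bound
    where
    N = proj₁ (small-blocks bd pc)
    bound : ∀ t M → ∑ (λ i → ∣ seq (a i) M ∣) (interval N (t N.∸ N)) ≤ frac 2 E + frac t M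
    bound t M = begin
      atM                                  ≃⟨ solve 2 (λ a b → a := b :+ (a :- b)) ≃-refl atM (blockAbs N t) ⟩
      blockAbs N t + (atM - blockAbs N t)  ≤⟨ +-mono-≤ (proj₂ (small-blocks bd pc) t)
                                                        (≤-trans (p≤∣p∣ (atM - blockAbs N t)) perturbation) ⟩
      inv E + (frac (length xs) M + frac (length xs) (precision t))
        ≤⟨ QP.+-monoʳ-≤ (inv E) (+-mono-≤ (frac-mono M length≤t)
                                           (≤-trans (frac-mono (precision t) length≤t) (t/precision≤ t))) ⟩
      inv E + (frac t M + inv E)           ≃⟨ solve 2 (λ i f → i :+ (f :+ i) := (i :+ i) :+ f) ≃-refl (inv E) (frac t M) ⟩
      (inv E + inv E) + frac t M           ≃⟨ QP.+-congˡ (frac t M) (frac-+ 1 1 E) ⟩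
      frac 2 E + frac t M                  ∎
      where
      xs = interval N (t N.∸ N)
      atM = ∑ (λ i → ∣ seq (a i) M ∣) xs
      length≤t : length xs N.≤ t
      length≤t = subst (N._≤ t) (sym (length-interval N (t N.∸ N))) (NP.m∸n≤m t N)
      perturbation : ∣ atM - blockAbs N t ∣ ≤ frac (length xs) M + frac (length xs) (precision t)
      perturbation = ∑-perturb (λ i → ∣ seq (a i) M ∣) (λ i → ∣ term t i ∣) M (precision t) xs
        (λ i → ≤-trans (abs-lemma (seq (a i) M) (term t i)) (reg (a i) M (precision t)))

tolerance : ℕ → ℕ
tolerance j = 4 N.* j N.+ 3

frac-tolerance : ∀ c j → c N.≤ 4 → frac c (tolerance j) ≤ inv j
frac-tolerance c j c≤4 = frac-≤ (NP.≤-trans (NP.*-monoˡ-≤ (suc j) c≤4) (NP.≤-reflexive (4[j+1] j)))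
  where
  4[j+1] : ∀ j → 4 N.* suc j ≡ 1 N.* suc (4 N.* j N.+ 3)
  4[j+1] = solve-∀

module AbsoluteLimit (a : ℕ → ℝ) (N : ℕ → ℕ)
  (tail : ∀ j t M → ∑ (λ i → ∣ seq (a i) M ∣) (interval (N j) (t N.∸ N j)) ≤ frac 2 (tolerance j) + frac t M)
  where

  absAt : ℕ → ℕ → ℚᵘ
  absAt M i = ∣ seq (a i) M ∣

  absAt-nonneg : ∀ M i → 0ℚᵘ ≤ absAt M i
  absAt-nonneg M i = 0≤∣p∣ (seq (a i) M)

  -- precision of the j-th approximation of the limit: fine enough that
  -- summing N j approximation errors costs at most 1/(tolerance j + 1)
  precision : ℕ → ℕ
  precision j = suc (N j) N.* suc (tolerance j)

  errors-≤ : ∀ j → frac (N j) (precision j) ≤ inv (tolerance j)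
  errors-≤ j = frac-≤ (NP.≤-trans (NP.m≤n+m (N j N.* suc (tolerance j)) (suc (tolerance j)))
    (NP.≤-trans (NP.n≤1+n _) (NP.≤-reflexive (sym (NP.*-identityˡ _)))))

  ≤-precision : ∀ j → j N.≤ precision j
  ≤-precision j = NP.≤-trans (NP.≤-trans (NP.m≤n*m j 4) (NP.≤-trans (NP.m≤m+n (4 N.* j) 3) (NP.n≤1+n _)))
                             (NP.m≤n*m (suc (tolerance j)) (suc (N j)))

  approx : ℕ → ℚᵘ
  approx j = ∑ (absAt (precision j)) (interval 0 (N j))

  changePrecision : ∀ M M' xs → ∣ ∑ (absAt M) xs - ∑ (absAt M') xs ∣ ≤ frac (length xs) M + frac (length xs) M'
  changePrecision M M' xs = ∑-perturb (absAt M) (absAt M') M M' xs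
    (λ i → ≤-trans (abs-lemma (seq (a i) M) (seq (a i) M')) (reg (a i) M M'))

  -- approx j and approx j' differ by a change of precision on [0, N j) and
  -- the block [N j, N j'), which is small
  approx-regular-≤ : ∀ j j' → N j N.≤ N j' → ∣ approx j - approx j' ∣ ≤ inv j + inv j'
  approx-regular-≤ j j' N≤N' = begin
    ∣ approx j - approx j' ∣  ≃⟨ QP.∣-∣-cong (QP.+-congʳ (approx j) (QP.-‿cong (∑-split (absAt M') N.z≤n N≤N'))) ⟩
    ∣ A - (A' + T) ∣          ≤⟨ ≤-trans (≤-reflexive (QP.∣-∣-cong (solve 3 (λ x y z → x :- (y :+ z) := (x :- y) :- z) ≃-refl A A' T)))
                                          (QP.∣p-q∣≤∣p∣+∣q∣ (A - A') T) ⟩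
    ∣ A - A' ∣ + ∣ T ∣
      ≤⟨ +-mono-≤ (subst (λ l → ∣ A - A' ∣ ≤ frac l M + frac l M') (length-interval 0 n) (changePrecision M M' (interval 0 n)))
                  (≤-trans (≤-reflexive (QP.0≤p⇒∣p∣≃p (∑-nonneg (absAt M') (interval n (n' N.∸ n)) (absAt-nonneg M'))))
                           (tail j n' M')) ⟩
    (frac n M + frac n M') + (frac 2 (tolerance j) + frac n' M')
      ≤⟨ +-mono-≤ (+-mono-≤ (errors-≤ j) (≤-trans (frac-mono M' N≤N') (errors-≤ j')))
                  (QP.+-monoʳ-≤ (frac 2 (tolerance j)) (errors-≤ j')) ⟩
    (frac 1 (tolerance j) + frac 1 (tolerance j')) + (frac 2 (tolerance j) + frac 1 (tolerance j'))
      ≃⟨ solve 4 (λ a b c d → (a :+ b) :+ (c :+ d) := (a :+ c) :+ (b :+ d)) ≃-refl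
               (frac 1 (tolerance j)) (frac 1 (tolerance j')) (frac 2 (tolerance j)) (frac 1 (tolerance j')) ⟩
    (frac 1 (tolerance j) + frac 2 (tolerance j)) + (frac 1 (tolerance j') + frac 1 (tolerance j'))
      ≃⟨ QP.+-cong (frac-+ 1 2 (tolerance j)) (frac-+ 1 1 (tolerance j')) ⟩
    frac 3 (tolerance j) + frac 2 (tolerance j')
      ≤⟨ +-mono-≤ (frac-tolerance 3 j (N.s≤s (N.s≤s (N.s≤s N.z≤n)))) (frac-tolerance 2 j' (N.s≤s (N.s≤s N.z≤n))) ⟩
    inv j + inv j' ∎
    where
    M = precision j
    M' = precision j'
    n = N j
    n' = N j'
    A = ∑ (absAt M) (interval 0 n)
    A' = ∑ (absAt M') (interval 0 n)
    T = ∑ (absAt M') (interval n (n' N.∸ n))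

  approx-regular : ∀ j j' → ∣ approx j - approx j' ∣ ≤ inv j + inv j'
  approx-regular j j' with NP.≤-total (N j) (N j')
  ... | inj₁ N≤N' = approx-regular-≤ j j' N≤N'
  ... | inj₂ N'≤N = ≤-trans (≤-reflexive (dist-sym (approx j) (approx j')))
    (≤-trans (approx-regular-≤ j' j N'≤N) (≤-reflexive (QP.+-comm (inv j') (inv j))))

  limit : ℝ
  limit = mkℝ approx approx-regular

  -- Beyond N k, a rational partial sum at the precision of approx m is
  -- close to approx m: the difference is a block beyond N k or beyond N m.
  partial-vs-approx : ∀ k n m → N k N.≤ n →
    ∣ ∑ (absAt (precision m)) (interval 0 n) - approx m ∣
      ≤ (frac 2 (tolerance k) + frac (N m) (precision m)) + (frac 2 (tolerance m) + frac n (precision m))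
  partial-vs-approx k n m Nk≤n with NP.≤-total n (N m)
  ... | inj₁ n≤Nm = begin
    ∣ Sn - approx m ∣        ≃⟨ QP.∣-∣-cong (QP.+-congʳ Sn (QP.-‿cong (∑-split (absAt M) N.z≤n n≤Nm))) ⟩
    ∣ Sn - (Sn + T) ∣        ≃⟨ ≃-trans (dist-sym Sn (Sn + T))
                                        (QP.∣-∣-cong (solve 2 (λ x z → (x :+ z) :- x := z) ≃-refl Sn T)) ⟩
    ∣ T ∣                    ≃⟨ QP.0≤p⇒∣p∣≃p (∑-nonneg (absAt M) (interval n (N m N.∸ n)) (absAt-nonneg M)) ⟩
    T                        ≤⟨ ∑-suffix-≤ (absAt M) (absAt-nonneg M) Nk≤n n≤Nm ⟩
    ∑ (absAt M) (interval (N k) (N m N.∸ N k)) ≤⟨ tail k (N m) M ⟩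
    frac 2 (tolerance k) + frac (N m) M
      ≤⟨ ≤-+-nonneg (nonneg-+ (frac-nonneg 2 (tolerance m)) (frac-nonneg n M)) ⟩
    (frac 2 (tolerance k) + frac (N m) M) + (frac 2 (tolerance m) + frac n M) ∎
    where
    M = precision m
    Sn = ∑ (absAt M) (interval 0 n)
    T = ∑ (absAt M) (interval n (N m N.∸ n))
  ... | inj₂ Nm≤n = begin
    ∣ Sn - approx m ∣        ≃⟨ QP.∣-∣-cong (QP.+-congˡ (- approx m) (∑-split (absAt M) N.z≤n Nm≤n)) ⟩
    ∣ (approx m + T) - approx m ∣ ≃⟨ QP.∣-∣-cong (solve 2 (λ x z → (x :+ z) :- x := z) ≃-refl (approx m) T) ⟩
    ∣ T ∣                    ≃⟨ QP.0≤p⇒∣p∣≃p (∑-nonneg (absAt M) (interval (N m) (n N.∸ N m)) (absAt-nonneg M)) ⟩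
    T                        ≤⟨ tail m n M ⟩
    frac 2 (tolerance m) + frac n M
      ≤⟨ ≤-nonneg-+ (nonneg-+ (frac-nonneg 2 (tolerance k)) (frac-nonneg (N m) M)) ⟩
    (frac 2 (tolerance k) + frac (N m) M) + (frac 2 (tolerance m) + frac n M) ∎
    where
    M = precision m
    Sn = ∑ (absAt M) (interval 0 n)
    T = ∑ (absAt M) (interval (N m) (n N.∸ N m))

  partialSums : ℕ → ℝ
  partialSums = partialSum (λ i → ∣ a i ∣ᵣ)

  partialError : ℕ → ℕ
  partialError n = ((n N.+ n) N.+ n) N.+ 2

  partialSums-near-limit : ∀ k n → N k N.≤ n → ∀ m →
    ∣ seq (partialSums n) m - approx m ∣ ≤ inv k + frac (partialError n) m
  partialSums-near-limit k n Nk≤n m = begin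
    ∣ Pm - approx m ∣          ≤⟨ dist-triangle Pm Sn (approx m) ⟩
    ∣ Pm - Sn ∣ + ∣ Sn - approx m ∣
      ≤⟨ +-mono-≤ (partialSum-approx (λ i → ∣ a i ∣ᵣ) n m M) (partial-vs-approx k n m Nk≤n) ⟩
    (frac n m + frac n M) + ((frac 2 (tolerance k) + frac (N m) M) + (frac 2 (tolerance m) + frac n M))
      ≤⟨ +-mono-≤ (QP.+-monoʳ-≤ (frac n m) n/M≤n/m)
                  (+-mono-≤ (+-mono-≤ (frac-tolerance 2 k (N.s≤s (N.s≤s N.z≤n)))
                                      (≤-trans (errors-≤ m) (frac-tolerance 1 m (N.s≤s N.z≤n))))
                            (+-mono-≤ (frac-tolerance 2 m (N.s≤s (N.s≤s N.z≤n))) n/M≤n/m)) ⟩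
    (frac n m + frac n m) + ((inv k + inv m) + (inv m + frac n m))
      ≃⟨ solve 3 (λ f i j → (f :+ f) :+ ((i :+ j) :+ (j :+ f)) := i :+ (((f :+ f) :+ f) :+ (j :+ j)))
               ≃-refl (frac n m) (inv k) (inv m) ⟩
    inv k + (((frac n m + frac n m) + frac n m) + (inv m + inv m))
      ≃⟨ QP.+-congʳ (inv k) (≃-trans (QP.+-cong (≃-trans (QP.+-congˡ (frac n m) (frac-+ n n m))
                                                         (frac-+ (n N.+ n) n m))
                                                (frac-+ 1 1 m))
                                     (frac-+ ((n N.+ n) N.+ n) 2 m)) ⟩
    inv k + frac (partialError n) m ∎
    where
    M = precision m
    Pm = seq (partialSums n) m
    Sn = ∑ (absAt M) (interval 0 n)
    n/M≤n/m : frac n M ≤ frac n m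
    n/M≤n/m = frac-antitone n (≤-precision m)

  converges : partialSums ConvergesTo limit
  converges k = N k , λ n Nk≤n →
    dist-≤ᵣ (partialSums n) limit (inv k) (partialError n) (partialSums-near-limit k n Nk≤n)

theorem3p1 : BD-ℕ → (a : ℕ → ℝ) → PermutablyConvergent a → AbsolutelyConvergent a
theorem3p1 bd a pc = limit , converges
  where
  N : ℕ → ℕ
  N j = proj₁ (TailBound.small-tails a (tolerance j) bd pc)
  open AbsoluteLimit a N (λ j → proj₂ (TailBound.small-tails a (tolerance j) bd pc))
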